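{- Let $q$ be a prime power. Every blocking set $\mathcal{B}$ in $\mathrm{PG}(2,q)$ of size $k\le 2q-1$ does not have the $r_\infty$-property with respect to any point $P\in\mathcal{B}$.
   Context: A blocking set of $\mathrm{PG}(2,q)$ is a set of points meeting every line and containing no line. A line is tangent to a point set $\mathcal{K}$ if it meets $\mathcal{K}$ in exactly one point, secant if in more than one. A blocking set $\mathcal{B}$ has the $r_\infty$-property with respect to $P\in\mathcal{B}$ if exactly one line through $P$ is tangent to $\mathcal{B}$ and all other lines through $P$ are secants. -}

module Defs where

open import Level using (0ℓ)
open import Data.Nat using (ℕ; _≤_)
open import Data.Fin using (Fin)
open import Data.Product using (Σ; ∃; _×_; _,_; proj₁; proj₂)
open import Data.Sum using (_⊎_)
open import Data.List using (List; length; filter; map)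
open import Data.List.Membership.Propositional using (_∈_)
open import Data.List.Relation.Unary.Unique.Propositional using (Unique)
open import Relation.Nullary using (¬_; Dec)
open import Relation.Binary.PropositionalEquality using (_≡_; _≢_)
open import Relation.Binary.Definitions using (DecidableEquality)
open import Algebra.Structures using (IsCommutativeRing)
open import Function.Bundles using (_↔_)

-- A finite field of order `order` (with propositional equality).
-- Every such field is GF(q) for a prime power q = order, so
-- PG(2, q) = PG(2, F).
record FiniteField : Set₁ where
  field
    Carrier : Set
    _+_ _*_ : Carrier → Carrier → Carrier
    -_ : Carrier → Carrier
    0# 1# : Carrier
    isCommutativeRing : IsCommutativeRing _≡_ _+_ _*_ -_ 0# 1#
    0≢1 : 0# ≢ 1#
    inverse : ∀ x → x ≢ 0# → ∃ λ y → x * y ≡ 1#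
    _≟_ : DecidableEquality Carrier
    order : ℕ
    enumeration : Fin order ↔ Carrier

module _ (F : FiniteField) where
  open FiniteField F

  Triple : Set
  Triple = Carrier × Carrier × Carrier

  -- canonical representative of a projective point: the first nonzero
  -- homogeneous coordinate equals 1
  Normalized : Triple → Set
  Normalized (x , y , z) =
    (x ≡ 1#) ⊎ ((x ≡ 0#) × (y ≡ 1#)) ⊎ ((x ≡ 0#) × (y ≡ 0#) × (z ≡ 1#))

  -- points of PG(2,F); lines are represented dually by the same type:
  -- the line [a,b,c] is { (x,y,z) : a x + b y + c z = 0 }
  Point : Set
  Point = Σ Triple Normalized

  Line : Set
  Line = Σ Triple Normalized

  coords : Σ Triple Normalized → Triple
  coords = proj₁

  Incident : Point → Line → Set
  Incident ((x , y , z) , _) ((a , b , c) , _) = ((a * x) + (b * y)) + (c * z) ≡ 0#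

  incident? : (ℓ : Line) → (P : Point) → Dec (Incident P ℓ)
  incident? ((a , b , c) , _) ((x , y , z) , _) = (((a * x) + (b * y)) + (c * z)) ≟ 0#

  _∈ₚ_ : Point → List Point → Set
  P ∈ₚ K = coords P ∈ map coords K

  IsPointSet : List Point → Set
  IsPointSet K = Unique (map coords K)

  meet : List Point → Line → ℕ
  meet K ℓ = length (filter (incident? ℓ) K)

  Tangent : List Point → Line → Set
  Tangent K ℓ = meet K ℓ ≡ 1

  Secant : List Point → Line → Set
  Secant K ℓ = 2 ≤ meet K ℓ

  IsBlockingSet : List Point → Set
  IsBlockingSet B =
    IsPointSet B
    × (∀ (ℓ : Line) → ∃ λ (P : Point) → Incident P ℓ × P ∈ₚ B)
    × (∀ (ℓ : Line) → ∃ λ (P : Point) → Incident P ℓ × ¬ (P ∈ₚ B))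

  HasRInfProperty : List Point → Point → Set
  HasRInfProperty B P =
    ∃ λ (ℓ : Line) → Incident P ℓ × Tangent B ℓ
      × (∀ (m : Line) → Incident P m → coords m ≢ coords ℓ → Secant B m)

module Submission where

-- Let ℓ be the unique tangent to B through P ∈ B and pick a second point O ∈ B; it lies off ℓ.
-- In dual coordinates, with u, w a basis of the lines through O, the lines missing O are, up to
-- scaling, ℓ + s u + t w.  For (s , t) ≠ (0 , 0) such a line differs from ℓ, hence contains a
-- point of B other than P (as a secant through P, or because B blocks it) and other than O.
-- So the product over x ∈ B ∖ {P , O} of the affine forms (ℓ + s u + t w) · x vanishes on
-- F² ∖ {0} but not at the origin, where every factor is ℓ · x ≠ 0.  Since Σ_{x ∈ F} xⁱ = 0 for
-- i < q − 1, the sum over F² of any polynomial of degree at most 2q − 3 vanishes, whereas here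
-- it equals the value at the origin.  Hence the degree |B| − 2 exceeds 2q − 3.

open import Defs

open import Algebra.Bundles using (CommutativeRing)
open import Data.Fin using (Fin; zero; suc; punchIn)
open import Data.Fin.Permutation using (Permutation′; _⟨$⟩ʳ_)
open import Data.Fin.Properties using (suc-injective; punchIn-injective; punchInᵢ≢i)
open import Data.List using (List; []; _∷_; _++_; length; filter; map)
open import Data.List.Membership.Propositional using (_∈_)
open import Data.List.Membership.Propositional.Properties using (∈-map⁺; ∈-map⁻; ∈-filter⁺; ∈-filter⁻)
open import Data.List.Properties using (length-map; filter-notAll)
open import Data.List.Relation.Unary.All as All using (All; []; _∷_)
import Data.List.Relation.Unary.All.Properties as Allₚ
open import Data.List.Relation.Unary.AllPairs using (_∷_)
open import Data.List.Relation.Unary.Any as Any using (here; there)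
open import Data.List.Relation.Unary.Unique.Propositional using (Unique)
open import Data.List.Relation.Unary.Unique.Propositional.Properties using (filter⁺)
open import Data.Nat as ℕ using (ℕ; zero; suc; pred; _∸_; _≤_; _<_; s≤s; z≤n)
import Data.Nat.Properties as ℕₚ
open import Data.Product using (∃; _×_; _,_; proj₁; proj₂)
open import Data.Product.Properties using (≡-dec)
open import Data.Sum using (_⊎_; inj₁; inj₂; [_,_]′)
open import Data.Vec using (Vec; []; _∷_)
open import Function using (_∘_; _↔_; Inverse; Injection; mk↔ₛ′)
open import Function.Definitions using (Injective)
open import Function.Properties.Inverse using (↔-sym; ↔-trans; Inverse⇒Injection)
open import Relation.Binary.Definitions using (DecidableEquality)
open import Relation.Binary.PropositionalEquality
  using (_≡_; _≢_; refl; sym; trans; cong; cong₂; subst; subst₂; module ≡-Reasoning)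
open import Relation.Nullary using (¬_; yes; no; contradiction; ¬?)
open import Relation.Unary using (Pred; Decidable)

module _ {a} {A : Set a} where

  length≡1⇒∈-unique : ∀ {xs : List A} {x y} → length xs ≡ 1 → x ∈ xs → y ∈ xs → x ≡ y
  length≡1⇒∈-unique {_ ∷ []} _ (here refl) (here refl) = refl

  Unique∧length≥2⇒∃≢ : DecidableEquality A → ∀ {xs} x → Unique xs → 2 ≤ length xs →
                       ∃ λ y → y ∈ xs × y ≢ x
  Unique∧length≥2⇒∃≢ _≟_ {_ ∷ []} x _ (s≤s ())
  Unique∧length≥2⇒∃≢ _≟_ {y ∷ z ∷ _} x ((y≢z ∷ _) ∷ _) _ with y ≟ x
  ... | no y≢x = y , here refl , y≢x
  ... | yes refl = z , there (here refl) , y≢z ∘ sym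

  enumeration-avoiding : ∀ {n} → Fin n ↔ A → (x : A) →
                         ∃ λ (g : Fin (pred n) → A) → Injective _≡_ _≡_ g × (∀ k → g k ≢ x)
  enumeration-avoiding {zero} e x with () ← Inverse.from e x
  enumeration-avoiding {suc n} e x =
    to ∘ punchIn i , punchIn-injective i _ _ ∘ to-injective , λ k → punchInᵢ≢i i k ∘ to≡x⇒≡i
    where
    open Inverse e
    i = from x
    to-injective = Injection.injective (Inverse⇒Injection e)
    to≡x⇒≡i : ∀ {k} → to k ≡ x → k ≡ i
    to≡x⇒≡i {k} eq = trans (sym (strictlyInverseʳ k)) (cong from eq)

module _ {a b p} {A : Set a} {B : Set b} {P : Pred B p} (P? : Decidable P) (f : A → B) where

  length-filter-map : ∀ xs → length (filter P? (map f xs)) ≡ length (filter (P? ∘ f) xs)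
  length-filter-map [] = refl
  length-filter-map (x ∷ xs) with P? (f x)
  ... | yes _ = cong suc (length-filter-map xs)
  ... | no _ = length-filter-map xs

module Without {a} {A : Set a} (_≟_ : DecidableEquality A) where

  _without_ : List A → A → List A
  xs without x = filter (λ y → ¬? (y ≟ x)) xs

  length-without : ∀ {x xs} → x ∈ xs → length (xs without x) < length xs
  length-without x∈xs = filter-notAll (λ y → ¬? (y ≟ _)) _ (Any.map (λ x≡y y≢x → y≢x (sym x≡y)) x∈xs)

  ∈-without⁺ : ∀ {x y xs} → y ∈ xs → y ≢ x → y ∈ xs without x
  ∈-without⁺ = ∈-filter⁺ (λ y → ¬? (y ≟ _))

  ∈-without⁻ : ∀ {x y xs} → y ∈ xs without x → y ∈ xs × y ≢ x
  ∈-without⁻ = ∈-filter⁻ (λ y → ¬? (y ≟ _))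

i+j≤2q-3⇒i≤q-2⊎j≤q-2 : ∀ {i j d q} → i ℕ.+ j ≤ d → 2 ℕ.+ d ≤ 2 ℕ.* q ∸ 1 → suc i < q ⊎ suc j < q
i+j≤2q-3⇒i≤q-2⊎j≤q-2 {i} {j} {d} {q} i+j≤d 2+d≤2q-1 with suc i ℕₚ.<? q | suc j ℕₚ.<? q
... | yes 1+i<q | _ = inj₁ 1+i<q
... | no _ | yes 1+j<q = inj₂ 1+j<q
... | no 1+i≮q | no 1+j≮q = contradiction 2+d≤2q-1 (<⇒≱ (begin-strict
  2 ℕ.* q ∸ 1              ≤⟨ ∸-monoˡ-≤ 1 (+-mono-≤ (≮⇒≥ 1+i≮q) (+-monoˡ-≤ 0 (≮⇒≥ 1+j≮q))) ⟩
  i ℕ.+ (suc j ℕ.+ 0)      ≡⟨ cong (i ℕ.+_) (+-identityʳ (suc j)) ⟩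
  i ℕ.+ suc j              ≡⟨ +-suc i j ⟩
  suc (i ℕ.+ j)            ≤⟨ s≤s i+j≤d ⟩
  suc d                    <⟨ n<1+n (suc d) ⟩
  2 ℕ.+ d                  ∎))
  where
  open ℕₚ using (<⇒≱; ≮⇒≥; ∸-monoˡ-≤; +-mono-≤; +-monoˡ-≤; +-identityʳ; +-suc; n<1+n; module ≤-Reasoning)
  open ≤-Reasoning

module Field (F : FiniteField) where

  open FiniteField F public using (Carrier; _≟_; order; enumeration; inverse; 0≢1)

  commutativeRing : CommutativeRing _ _
  commutativeRing = record { isCommutativeRing = FiniteField.isCommutativeRing F }

  open CommutativeRing commutativeRing public
    using (_+_; _*_; -_; 0#; 1#; +-identityˡ; +-identityʳ; *-identityˡ; *-identityʳ; zeroˡ; zeroʳ;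
           +-assoc; *-assoc; *-comm; distribˡ; -‿inverseˡ; -‿inverseʳ; semiring; commutativeSemiring)

  -- A semiring solver: a negation enters it as an atom, so cancellations such as - y + y ≡ 0#
  -- are done by hand and identities are stated without subtraction where possible.
  open import Algebra.Solver.Ring.NaturalCoefficients.Default commutativeSemiring public
    using (solve; _:=_; _:+_; _:*_; con)
  open import Algebra.Properties.Group (CommutativeRing.+-group commutativeRing) public using (identityʳ-unique)
  open import Algebra.Properties.Semiring.Exp semiring public using (_^_)
  open import Algebra.Properties.CommutativeSemiring.Exp commutativeSemiring public using (^-distrib-*)

  open ≡-Reasoning

  *-cancelʳ : ∀ {a x y} → a ≢ 0# → x * a ≡ y * a → x ≡ y
  *-cancelʳ {a} {x} {y} a≢0 xa≡ya with inverse a a≢0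
  ... | a⁻¹ , aa⁻¹≡1 = begin
    x              ≡⟨ z*a*a⁻¹≡z x ⟨
    x * a * a⁻¹    ≡⟨ cong (_* a⁻¹) xa≡ya ⟩
    y * a * a⁻¹    ≡⟨ z*a*a⁻¹≡z y ⟩
    y              ∎
    where
    z*a*a⁻¹≡z : ∀ z → z * a * a⁻¹ ≡ z
    z*a*a⁻¹≡z z = trans (*-assoc z a a⁻¹) (trans (cong (z *_) aa⁻¹≡1) (*-identityʳ z))

  x*y≡0⇒y≡0 : ∀ {x y} → x ≢ 0# → x * y ≡ 0# → y ≡ 0#
  x*y≡0⇒y≡0 {x} {y} x≢0 xy≡0 = *-cancelʳ x≢0 (trans (*-comm y x) (trans xy≡0 (sym (zeroˡ x))))

  x*y≢0 : ∀ {x y} → x ≢ 0# → y ≢ 0# → x * y ≢ 0#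
  x*y≢0 x≢0 y≢0 = y≢0 ∘ x*y≡0⇒y≡0 x≢0

  1≢0 : 1# ≢ 0#
  1≢0 = 0≢1 ∘ sym

  -1≢0 : - 1# ≢ 0#
  -1≢0 -1≡0 = 1≢0 (begin
    1#          ≡⟨ +-identityʳ 1# ⟨
    1# + 0#     ≡⟨ cong (1# +_) -1≡0 ⟨
    1# + - 1#   ≡⟨ -‿inverseʳ 1# ⟩
    0#          ∎)

  inverse≢0 : ∀ {a} → a ≢ 0# → ∃ λ a⁻¹ → a⁻¹ ≢ 0# × a⁻¹ * a ≡ 1#
  inverse≢0 {a} a≢0 with inverse a a≢0
  ... | a⁻¹ , aa⁻¹≡1 = a⁻¹ , a⁻¹≢0 , trans (*-comm a⁻¹ a) aa⁻¹≡1
    where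
    a⁻¹≢0 : a⁻¹ ≢ 0#
    a⁻¹≢0 a⁻¹≡0 = 0≢1 (trans (sym (zeroʳ a)) (trans (cong (a *_) (sym a⁻¹≡0)) aa⁻¹≡1))

module Polynomial (F : FiniteField) where

  open Field F
  open ≡-Reasoning

  ⟦_⟧ : ∀ {n} → Vec Carrier n → Carrier → Carrier
  ⟦ [] ⟧ x = 0#
  ⟦ c ∷ cs ⟧ x = c + x * ⟦ cs ⟧ x

  quotient : ∀ {n} → Vec Carrier (suc n) → Carrier → Vec Carrier n
  quotient (c ∷ []) r = []
  quotient (c ∷ cs@(_ ∷ _)) r = ⟦ cs ⟧ r ∷ quotient cs r

  -- p(x) − p(r) = (x − r) q(x), rearranged so that no subtraction occurs.
  division : ∀ {n} (p : Vec Carrier (suc n)) r x →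
             ⟦ p ⟧ x + r * ⟦ quotient p r ⟧ x ≡ x * ⟦ quotient p r ⟧ x + ⟦ p ⟧ r
  division (c ∷ []) r x =
    solve 3 (λ c r x → c :+ x :* con 0 :+ r :* con 0 := x :* con 0 :+ (c :+ r :* con 0)) refl c r x
  division (c ∷ cs@(_ ∷ _)) r x = begin
    c + x * P + r * (R + x * Q)
      ≡⟨ solve 6 (λ c x P r R Q → c :+ x :* P :+ r :* (R :+ x :* Q)
                                 := c :+ r :* R :+ x :* (P :+ r :* Q)) refl c x P r R Q ⟩
    c + r * R + x * (P + r * Q)
      ≡⟨ cong (λ z → c + r * R + x * z) (division cs r x) ⟩
    c + r * R + x * (x * Q + R)
      ≡⟨ solve 5 (λ c r R x Q → c :+ r :* R :+ x :* (x :* Q :+ R)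
                               := x :* (R :+ x :* Q) :+ (c :+ r :* R)) refl c r R x Q ⟩
    x * (R + x * Q) + (c + r * R)  ∎
    where
    P = ⟦ cs ⟧ x
    R = ⟦ cs ⟧ r
    Q = ⟦ quotient cs r ⟧ x

  roots⇒vanishes : ∀ {n m} (p : Vec Carrier n) (g : Fin m → Carrier) → Injective _≡_ _≡_ g → n ≤ m →
                   (∀ k → ⟦ p ⟧ (g k) ≡ 0#) → ∀ x → ⟦ p ⟧ x ≡ 0#
  roots⇒vanishes [] g g-injective n≤m p∘g≡0 x = refl
  roots⇒vanishes {suc n} {suc m} p g g-injective (s≤s n≤m) p∘g≡0 x = begin
    ⟦ p ⟧ x                  ≡⟨ solve 2 (λ P r → P := P :+ r :* con 0) refl (⟦ p ⟧ x) r ⟩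
    ⟦ p ⟧ x + r * 0#         ≡⟨ cong (λ z → ⟦ p ⟧ x + r * z) (q≡0 x) ⟨
    ⟦ p ⟧ x + r * ⟦ q ⟧ x    ≡⟨ division p r x ⟩
    x * ⟦ q ⟧ x + ⟦ p ⟧ r    ≡⟨ cong₂ (λ y z → x * y + z) (q≡0 x) (p∘g≡0 zero) ⟩
    x * 0# + 0#              ≡⟨ solve 1 (λ x → x :* con 0 :+ con 0 := con 0) refl x ⟩
    0#                       ∎
    where
    r = g zero
    q = quotient p r
    q∘g≡0 : ∀ k → ⟦ q ⟧ (g (suc k)) ≡ 0#
    q∘g≡0 k with ⟦ q ⟧ (g (suc k)) ≟ 0#
    ... | yes q[y]≡0 = q[y]≡0
    ... | no q[y]≢0 = contradiction (g-injective (*-cancelʳ q[y]≢0 r*q[y]≡y*q[y])) λ ()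
      where
      y = g (suc k)
      r*q[y]≡y*q[y] : r * ⟦ q ⟧ y ≡ y * ⟦ q ⟧ y
      r*q[y]≡y*q[y] = begin
        r * ⟦ q ⟧ y                  ≡⟨ +-identityˡ _ ⟨
        0# + r * ⟦ q ⟧ y             ≡⟨ cong (_+ r * ⟦ q ⟧ y) (p∘g≡0 (suc k)) ⟨
        ⟦ p ⟧ y + r * ⟦ q ⟧ y        ≡⟨ division p r y ⟩
        y * ⟦ q ⟧ y + ⟦ p ⟧ r        ≡⟨ cong (y * ⟦ q ⟧ y +_) (p∘g≡0 zero) ⟩
        y * ⟦ q ⟧ y + 0#             ≡⟨ +-identityʳ _ ⟩
        y * ⟦ q ⟧ y                  ∎
    q≡0 : ∀ x → ⟦ q ⟧ x ≡ 0#
    q≡0 = roots⇒vanishes q (g ∘ suc) (suc-injective ∘ g-injective) n≤m q∘g≡0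

  X^ : ∀ j → Vec Carrier (suc j)
  X^ zero = 1# ∷ []
  X^ (suc j) = 0# ∷ X^ j

  ⟦X^⟧ : ∀ j x → ⟦ X^ j ⟧ x ≡ x ^ j
  ⟦X^⟧ zero x = solve 1 (λ x → con 1 :+ x :* con 0 := con 1) refl x
  ⟦X^⟧ (suc j) x = trans (+-identityˡ _) (cong (x *_) (⟦X^⟧ j x))

module PowerSum (F : FiniteField) where

  open Field F
  open Polynomial F
  open Inverse enumeration using (to; from; strictlyInverseˡ; strictlyInverseʳ)
  open import Algebra.Properties.Semiring.Sum semiring
    using (sum; sum-cong-≗; ∑-distrib-+; *-distribˡ-sum; *-distribʳ-sum; ∑-permute; sum-remove; sum-replicate-zero)
  open ≡-Reasoning

  sum-delta : ∀ {n} (v : Fin n → Carrier) i → (∀ j → j ≢ i → v j ≡ 0#) → sum v ≡ v i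
  sum-delta {suc n} v i v≡0 = begin
    sum v                          ≡⟨ sum-remove v ⟩
    v i + sum (v ∘ punchIn i)      ≡⟨ cong (v i +_) (sum-cong-≗ (λ k → v≡0 (punchIn i k) (punchInᵢ≢i i k))) ⟩
    v i + sum {n} (λ _ → 0#)       ≡⟨ cong (v i +_) (sum-replicate-zero n) ⟩
    v i + 0#                       ≡⟨ +-identityʳ (v i) ⟩
    v i                            ∎

  Σ : (Carrier → Carrier) → Carrier
  Σ f = sum (f ∘ to)

  Σ-cong : ∀ {f g} → (∀ x → f x ≡ g x) → Σ f ≡ Σ g
  Σ-cong f≗g = sum-cong-≗ (f≗g ∘ to)

  Σ-distrib-+ : ∀ f g → Σ (λ x → f x + g x) ≡ Σ f + Σ g
  Σ-distrib-+ f g = ∑-distrib-+ (f ∘ to) (g ∘ to)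

  *-distribˡ-Σ : ∀ c f → c * Σ f ≡ Σ (λ x → c * f x)
  *-distribˡ-Σ c f = *-distribˡ-sum c (f ∘ to)

  *-distribʳ-Σ : ∀ c f → Σ f * c ≡ Σ (λ x → f x * c)
  *-distribʳ-Σ c f = *-distribʳ-sum c (f ∘ to)

  Σ-reindex : ∀ f (π : Carrier ↔ Carrier) → Σ (f ∘ Inverse.to π) ≡ Σ f
  Σ-reindex f π = begin
    sum (f ∘ Inverse.to π ∘ to)    ≡⟨ sum-cong-≗ (λ i → cong f (strictlyInverseˡ (Inverse.to π (to i)))) ⟨
    sum (f ∘ to ∘ (π′ ⟨$⟩ʳ_))       ≡⟨ ∑-permute (f ∘ to) π′ ⟨
    sum (f ∘ to)                   ∎
    where
    π′ : Permutation′ order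
    π′ = ↔-trans enumeration (↔-trans π (↔-sym enumeration))

  Σ-delta : ∀ f a → (∀ x → x ≢ a → f x ≡ 0#) → Σ f ≡ f a
  Σ-delta f a f≡0 = trans (sum-delta (f ∘ to) (from a) (λ j j≢a → f≡0 (to j) (j≢a ∘ to≡a⇒≡from-a)))
                          (cong f (strictlyInverseˡ a))
    where
    to≡a⇒≡from-a : ∀ {j} → to j ≡ a → j ≡ from a
    to≡a⇒≡from-a {j} eq = trans (sym (strictlyInverseʳ j)) (cong from eq)

  Σ-zero : ∀ f → (∀ x → f x ≡ 0#) → Σ f ≡ 0#
  Σ-zero f f≡0 = trans (Σ-delta f 0# (λ x _ → f≡0 x)) (f≡0 0#)

  translation : Carrier ↔ Carrier
  translation = mk↔ₛ′ (_+ 1#) (_+ - 1#) (cancel 1# (-‿inverseˡ 1#)) (cancel (- 1#) (-‿inverseʳ 1#))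
    where
    cancel : ∀ a {b} → b + a ≡ 0# → ∀ x → x + b + a ≡ x
    cancel a {b} b+a≡0 x = trans (+-assoc x b a) (trans (cong (x +_) b+a≡0) (+-identityʳ x))

  scaling : ∀ {c} → c ≢ 0# → Carrier ↔ Carrier
  scaling {c} c≢0 with inverse≢0 c≢0
  ... | c⁻¹ , _ , c⁻¹c≡1 =
    mk↔ₛ′ (c *_) (c⁻¹ *_) (cancel c⁻¹ c (trans (*-comm c c⁻¹) c⁻¹c≡1)) (cancel c c⁻¹ c⁻¹c≡1)
    where
    cancel : ∀ a b → b * a ≡ 1# → ∀ x → b * (a * x) ≡ x
    cancel a b ba≡1 x = trans (sym (*-assoc b a x)) (trans (cong (_* x) ba≡1) (*-identityˡ x))

  Σ-1≡0 : Σ (λ _ → 1#) ≡ 0#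
  Σ-1≡0 = identityʳ-unique (Σ (λ x → x)) (Σ (λ _ → 1#)) (begin
    Σ (λ x → x) + Σ (λ _ → 1#)     ≡⟨ Σ-distrib-+ (λ x → x) (λ _ → 1#) ⟨
    Σ (λ x → x + 1#)               ≡⟨ Σ-reindex (λ x → x) translation ⟩
    Σ (λ x → x)                    ∎)

  powerSum : ℕ → Carrier
  powerSum i = Σ (_^ i)

  powerSum-scale : ∀ {c} → c ≢ 0# → ∀ i → c ^ i * powerSum i ≡ powerSum i
  powerSum-scale {c} c≢0 i = begin
    c ^ i * Σ (_^ i)           ≡⟨ *-distribˡ-Σ (c ^ i) (_^ i) ⟩
    Σ (λ x → c ^ i * x ^ i)    ≡⟨ Σ-cong (λ x → ^-distrib-* c x i) ⟨
    Σ (λ x → (c * x) ^ i)      ≡⟨ Σ-reindex (_^ i) (scaling c≢0) ⟩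
    Σ (_^ i)                   ∎

  -- If the sum were nonzero, powerSum-scale would make Xⁱ − 1 vanish at the q − 1 > i nonzero points.
  powerSum≡0 : ∀ i → suc i < order → powerSum i ≡ 0#
  powerSum≡0 zero _ = Σ-1≡0
  powerSum≡0 (suc j) 1+i<q with powerSum (suc j) ≟ 0# | enumeration-avoiding enumeration 0#
  ... | yes Sᵢ≡0 | _ = Sᵢ≡0
  ... | no Sᵢ≢0 | g , g-injective , g≢0 =
    contradiction (roots⇒vanishes p g g-injective (ℕₚ.<⇒≤pred 1+i<q) p∘g≡0 0#) p[0]≢0
    where
    p : Vec Carrier (suc (suc j))
    p = - 1# ∷ X^ j
    cⁱ≡1 : ∀ {c} → c ≢ 0# → c ^ suc j ≡ 1#
    cⁱ≡1 c≢0 = *-cancelʳ Sᵢ≢0 (trans (powerSum-scale c≢0 (suc j)) (sym (*-identityˡ _)))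
    p∘g≡0 : ∀ k → ⟦ p ⟧ (g k) ≡ 0#
    p∘g≡0 k = begin
      - 1# + g k * ⟦ X^ j ⟧ (g k)    ≡⟨ cong (λ y → - 1# + g k * y) (⟦X^⟧ j (g k)) ⟩
      - 1# + g k ^ suc j            ≡⟨ cong (- 1# +_) (cⁱ≡1 (g≢0 k)) ⟩
      - 1# + 1#                     ≡⟨ -‿inverseˡ 1# ⟩
      0#                            ∎
    p[0]≢0 : ⟦ p ⟧ 0# ≢ 0#
    p[0]≢0 = -1≢0 ∘ trans (sym (trans (cong (- 1# +_) (zeroˡ _)) (+-identityʳ _)))

module Bivariate (F : FiniteField) where

  open Field F
  open PowerSum F
  open ≡-Reasoning

  Monomial : Set
  Monomial = Carrier × ℕ × ℕ

  degree : Monomial → ℕ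
  degree (_ , i , j) = i ℕ.+ j

  ⟦_⟧ₘ : Monomial → Carrier → Carrier → Carrier
  ⟦ c , i , j ⟧ₘ s t = c * s ^ i * t ^ j

  ⟦_⟧ : List Monomial → Carrier → Carrier → Carrier
  ⟦ [] ⟧ s t = 0#
  ⟦ m ∷ f ⟧ s t = ⟦ m ⟧ₘ s t + ⟦ f ⟧ s t

  ⟦++⟧ : ∀ f g s t → ⟦ f ++ g ⟧ s t ≡ ⟦ f ⟧ s t + ⟦ g ⟧ s t
  ⟦++⟧ [] g s t = sym (+-identityˡ _)
  ⟦++⟧ (m ∷ f) g s t = trans (cong (⟦ m ⟧ₘ s t +_) (⟦++⟧ f g s t)) (sym (+-assoc _ _ _))

  Affine : Set
  Affine = Carrier × Carrier × Carrier

  ⟦_⟧ₐ : Affine → Carrier → Carrier → Carrier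
  ⟦ α , β , γ ⟧ₐ s t = α + s * β + t * γ

  ∏ₐ : List Affine → Carrier → Carrier → Carrier
  ∏ₐ [] s t = 1#
  ∏ₐ (a ∷ as) s t = ⟦ a ⟧ₐ s t * ∏ₐ as s t

  _·ₘ_ : Affine → Monomial → List Monomial
  (α , β , γ) ·ₘ (c , i , j) = (α * c , i , j) ∷ (β * c , suc i , j) ∷ (γ * c , i , suc j) ∷ []

  _·_ : Affine → List Monomial → List Monomial
  a · [] = []
  a · (m ∷ f) = a ·ₘ m ++ a · f

  ⟦·ₘ⟧ : ∀ a m s t → ⟦ a ·ₘ m ⟧ s t ≡ ⟦ a ⟧ₐ s t * ⟦ m ⟧ₘ s t
  ⟦·ₘ⟧ (α , β , γ) (c , i , j) s t =
    solve 8 (λ α β γ c s t sⁱ tʲ →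
              α :* c :* sⁱ :* tʲ :+ (β :* c :* (s :* sⁱ) :* tʲ :+ (γ :* c :* sⁱ :* (t :* tʲ) :+ con 0))
              := (α :+ s :* β :+ t :* γ) :* (c :* sⁱ :* tʲ))
            refl α β γ c s t (s ^ i) (t ^ j)

  ⟦·⟧ : ∀ a f s t → ⟦ a · f ⟧ s t ≡ ⟦ a ⟧ₐ s t * ⟦ f ⟧ s t
  ⟦·⟧ a [] s t = sym (zeroʳ _)
  ⟦·⟧ a (m ∷ f) s t = begin
    ⟦ a ·ₘ m ++ a · f ⟧ s t                        ≡⟨ ⟦++⟧ (a ·ₘ m) (a · f) s t ⟩
    ⟦ a ·ₘ m ⟧ s t + ⟦ a · f ⟧ s t                 ≡⟨ cong₂ _+_ (⟦·ₘ⟧ a m s t) (⟦·⟧ a f s t) ⟩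
    ⟦ a ⟧ₐ s t * ⟦ m ⟧ₘ s t + ⟦ a ⟧ₐ s t * ⟦ f ⟧ s t  ≡⟨ distribˡ _ _ _ ⟨
    ⟦ a ⟧ₐ s t * (⟦ m ⟧ₘ s t + ⟦ f ⟧ s t)            ∎

  degree-· : ∀ {d} a f → All (λ m → degree m ≤ d) f → All (λ m → degree m ≤ suc d) (a · f)
  degree-· a [] [] = []
  degree-· {d} a ((c , i , j) ∷ f) (i+j≤d ∷ f≤d) =
    ℕₚ.m≤n⇒m≤1+n i+j≤d ∷ s≤s i+j≤d ∷ subst (_≤ suc d) (sym (ℕₚ.+-suc i j)) (s≤s i+j≤d) ∷
    degree-· a f f≤d

  expand : List Affine → List Monomial
  expand [] = (1# , 0 , 0) ∷ []
  expand (a ∷ as) = a · expand as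

  ⟦expand⟧ : ∀ as s t → ⟦ expand as ⟧ s t ≡ ∏ₐ as s t
  ⟦expand⟧ [] s t = solve 0 (con 1 :* con 1 :* con 1 :+ con 0 := con 1) refl
  ⟦expand⟧ (a ∷ as) s t = trans (⟦·⟧ a (expand as) s t) (cong (⟦ a ⟧ₐ s t *_) (⟦expand⟧ as s t))

  degree-expand : ∀ as → All (λ m → degree m ≤ length as) (expand as)
  degree-expand [] = z≤n ∷ []
  degree-expand (a ∷ as) = degree-· a (expand as) (degree-expand as)

  Σ² : (Carrier → Carrier → Carrier) → Carrier
  Σ² f = Σ (λ s → Σ (f s))

  Σ²-distrib-+ : ∀ f g → Σ² (λ s t → f s t + g s t) ≡ Σ² f + Σ² g
  Σ²-distrib-+ f g = trans (Σ-cong (λ s → Σ-distrib-+ (f s) (g s))) (Σ-distrib-+ (Σ ∘ f) (Σ ∘ g))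

  Σ²-monomial : ∀ c i j → Σ² ⟦ c , i , j ⟧ₘ ≡ c * powerSum i * powerSum j
  Σ²-monomial c i j = begin
    Σ (λ s → Σ (λ t → c * s ^ i * t ^ j))   ≡⟨ Σ-cong (λ s → *-distribˡ-Σ (c * s ^ i) (_^ j)) ⟨
    Σ (λ s → c * s ^ i * powerSum j)        ≡⟨ *-distribʳ-Σ (powerSum j) (λ s → c * s ^ i) ⟨
    Σ (λ s → c * s ^ i) * powerSum j        ≡⟨ cong (_* powerSum j) (*-distribˡ-Σ c (_^ i)) ⟨
    c * powerSum i * powerSum j             ∎

  Σ²-low-degree : ∀ {d} f → All (λ m → degree m ≤ d) f → 2 ℕ.+ d ≤ 2 ℕ.* order ∸ 1 → Σ² ⟦ f ⟧ ≡ 0#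
  Σ²-low-degree [] [] _ = Σ-zero _ (λ s → Σ-zero _ (λ t → refl))
  Σ²-low-degree (m@(c , i , j) ∷ f) (i+j≤d ∷ f≤d) d≤2q-3 = begin
    Σ² ⟦ m ∷ f ⟧              ≡⟨ Σ²-distrib-+ ⟦ m ⟧ₘ ⟦ f ⟧ ⟩
    Σ² ⟦ m ⟧ₘ + Σ² ⟦ f ⟧      ≡⟨ cong₂ _+_ (trans (Σ²-monomial c i j) c*Sᵢ*Sⱼ≡0)
                                            (Σ²-low-degree f f≤d d≤2q-3) ⟩
    0# + 0#                   ≡⟨ +-identityʳ 0# ⟩
    0#                        ∎
    where
    c*Sᵢ*Sⱼ≡0 : c * powerSum i * powerSum j ≡ 0#
    c*Sᵢ*Sⱼ≡0 with i+j≤2q-3⇒i≤q-2⊎j≤q-2 i+j≤d d≤2q-3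
    ... | inj₁ 1+i<q = trans (cong (λ z → c * z * powerSum j) (powerSum≡0 i 1+i<q))
                             (trans (cong (_* powerSum j) (zeroʳ c)) (zeroˡ _))
    ... | inj₂ 1+j<q = trans (cong (c * powerSum i *_) (powerSum≡0 j 1+j<q)) (zeroʳ _)

  Σ²-delta : ∀ f → (∀ s t → s ≢ 0# ⊎ t ≢ 0# → f s t ≡ 0#) → Σ² f ≡ f 0# 0#
  Σ²-delta f f≡0 = begin
    Σ (λ s → Σ (f s))    ≡⟨ Σ-delta (Σ ∘ f) 0# (λ s s≢0 → Σ-zero (f s) (λ t → f≡0 s t (inj₁ s≢0))) ⟩
    Σ (f 0#)             ≡⟨ Σ-delta (f 0#) 0# (λ t t≢0 → f≡0 0# t (inj₂ t≢0)) ⟩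
    f 0# 0#              ∎

  ∏ₐ-vanishes-at-origin : ∀ as → 2 ℕ.+ length as ≤ 2 ℕ.* order ∸ 1 →
                          (∀ s t → s ≢ 0# ⊎ t ≢ 0# → ∏ₐ as s t ≡ 0#) → ∏ₐ as 0# 0# ≡ 0#
  ∏ₐ-vanishes-at-origin as |as|≤2q-3 ∏≡0 = begin
    ∏ₐ as 0# 0#          ≡⟨ Σ²-delta (∏ₐ as) ∏≡0 ⟨
    Σ² (∏ₐ as)           ≡⟨ Σ-cong (λ s → Σ-cong (⟦expand⟧ as s)) ⟨
    Σ² ⟦ expand as ⟧     ≡⟨ Σ²-low-degree (expand as) (degree-expand as) |as|≤2q-3 ⟩
    0#                   ∎

  ∏ₐ-∈ : ∀ {a as} s t → a ∈ as → ⟦ a ⟧ₐ s t ≡ 0# → ∏ₐ as s t ≡ 0#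
  ∏ₐ-∈ {as = _ ∷ as} s t (here refl) a≡0 = trans (cong (_* ∏ₐ as s t) a≡0) (zeroˡ _)
  ∏ₐ-∈ {as = b ∷ _} s t (there a∈as) a≡0 = trans (cong (⟦ b ⟧ₐ s t *_) (∏ₐ-∈ s t a∈as a≡0)) (zeroʳ _)

  ∏ₐ-≢0 : ∀ {as} s t → All (λ a → ⟦ a ⟧ₐ s t ≢ 0#) as → ∏ₐ as s t ≢ 0#
  ∏ₐ-≢0 s t [] = 1≢0
  ∏ₐ-≢0 s t (a≢0 ∷ as≢0) = x*y≢0 a≢0 (∏ₐ-≢0 s t as≢0)

module Plane (F : FiniteField) where

  open Field F
  open ≡-Reasoning

  Vector : Set
  Vector = Triple F

  infixl 6 _⊕_
  infixl 7 _⊛_ _∙_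

  _⊕_ : Vector → Vector → Vector
  (a , b , c) ⊕ (x , y , z) = a + x , b + y , c + z

  _⊛_ : Carrier → Vector → Vector
  k ⊛ (x , y , z) = k * x , k * y , k * z

  -- `Incident F X n` unfolds to `coords F n ∙ coords F X ≡ 0#`.
  _∙_ : Vector → Vector → Carrier
  (a , b , c) ∙ (x , y , z) = a * x + b * y + c * z

  𝟎 : Vector
  𝟎 = 0# , 0# , 0#

  _≟ᵥ_ : DecidableEquality Vector
  _≟ᵥ_ = ≡-dec _≟_ (≡-dec _≟_ _≟_)

  ∙-distribʳ-⊕ : ∀ a b x → (a ⊕ b) ∙ x ≡ a ∙ x + b ∙ x
  ∙-distribʳ-⊕ (a₁ , a₂ , a₃) (b₁ , b₂ , b₃) (x₁ , x₂ , x₃) =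
    solve 9 (λ a₁ a₂ a₃ b₁ b₂ b₃ x₁ x₂ x₃ →
              (a₁ :+ b₁) :* x₁ :+ (a₂ :+ b₂) :* x₂ :+ (a₃ :+ b₃) :* x₃
              := a₁ :* x₁ :+ a₂ :* x₂ :+ a₃ :* x₃ :+ (b₁ :* x₁ :+ b₂ :* x₂ :+ b₃ :* x₃))
            refl a₁ a₂ a₃ b₁ b₂ b₃ x₁ x₂ x₃

  ∙-⊛ : ∀ k a x → (k ⊛ a) ∙ x ≡ k * (a ∙ x)
  ∙-⊛ k (a₁ , a₂ , a₃) (x₁ , x₂ , x₃) =
    solve 7 (λ k a₁ a₂ a₃ x₁ x₂ x₃ →
              k :* a₁ :* x₁ :+ k :* a₂ :* x₂ :+ k :* a₃ :* x₃ := k :* (a₁ :* x₁ :+ a₂ :* x₂ :+ a₃ :* x₃))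
            refl k a₁ a₂ a₃ x₁ x₂ x₃

  ∙-zeroˡ : ∀ x → 𝟎 ∙ x ≡ 0#
  ∙-zeroˡ (x₁ , x₂ , x₃) =
    solve 3 (λ x₁ x₂ x₃ → con 0 :* x₁ :+ con 0 :* x₂ :+ con 0 :* x₃ := con 0) refl x₁ x₂ x₃

  ⊛-identityˡ : ∀ a → 1# ⊛ a ≡ a
  ⊛-identityˡ (a₁ , a₂ , a₃) = cong₂ _,_ (*-identityˡ a₁) (cong₂ _,_ (*-identityˡ a₂) (*-identityˡ a₃))

  ⊕-identityʳ-unique : ∀ a b → a ⊕ b ≡ a → b ≡ 𝟎
  ⊕-identityʳ-unique (a₁ , a₂ , a₃) (b₁ , b₂ , b₃) a⊕b≡a =
    cong₂ _,_ (identityʳ-unique a₁ b₁ (cong proj₁ a⊕b≡a))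
      (cong₂ _,_ (identityʳ-unique a₂ b₂ (cong (proj₁ ∘ proj₂) a⊕b≡a))
                 (identityʳ-unique a₃ b₃ (cong (proj₂ ∘ proj₂) a⊕b≡a)))

  proportional⇒≡ : ∀ {k m a o} → k ⊛ m ≡ a → m ∙ o ≡ a ∙ o → a ∙ o ≢ 0# → m ≡ a
  proportional⇒≡ {k} {m} {a} {o} k⊛m≡a m∙o≡a∙o a∙o≢0 = begin
    m         ≡⟨ ⊛-identityˡ m ⟨
    1# ⊛ m    ≡⟨ cong (_⊛ m) k≡1 ⟨
    k ⊛ m     ≡⟨ k⊛m≡a ⟩
    a         ∎
    where
    k≡1 : k ≡ 1#
    k≡1 = *-cancelʳ a∙o≢0 (begin
      k * (a ∙ o)     ≡⟨ cong (k *_) m∙o≡a∙o ⟨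
      k * (m ∙ o)     ≡⟨ ∙-⊛ k m o ⟨
      (k ⊛ m) ∙ o     ≡⟨ cong (_∙ o) k⊛m≡a ⟩
      a ∙ o           ≡⟨ *-identityˡ (a ∙ o) ⟨
      1# * (a ∙ o)    ∎)

  normalize : ∀ v → v ≢ 𝟎 → ∃ λ (n : Line F) → ∃ λ k → k ≢ 0# × coords F n ≡ k ⊛ v
  normalize (a , b , c) v≢𝟎 with a ≟ 0# | b ≟ 0# | c ≟ 0#
  ... | no a≢0 | _ | _ =
    let a⁻¹ , a⁻¹≢0 , a⁻¹a≡1 = inverse≢0 a≢0
    in ((1# , a⁻¹ * b , a⁻¹ * c) , inj₁ refl) , a⁻¹ , a⁻¹≢0 , cong (_, a⁻¹ * b , a⁻¹ * c) (sym a⁻¹a≡1)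
  ... | yes refl | no b≢0 | _ =
    let b⁻¹ , b⁻¹≢0 , b⁻¹b≡1 = inverse≢0 b≢0
    in ((0# , 1# , b⁻¹ * c) , inj₂ (inj₁ (refl , refl))) , b⁻¹ , b⁻¹≢0 ,
       cong₂ _,_ (sym (zeroʳ b⁻¹)) (cong (_, b⁻¹ * c) (sym b⁻¹b≡1))
  ... | yes refl | yes refl | no c≢0 =
    let c⁻¹ , c⁻¹≢0 , c⁻¹c≡1 = inverse≢0 c≢0
    in ((0# , 0# , 1#) , inj₂ (inj₂ (refl , refl , refl))) , c⁻¹ , c⁻¹≢0 ,
       cong₂ _,_ (sym (zeroʳ c⁻¹)) (cong₂ _,_ (sym (zeroʳ c⁻¹)) (sym c⁻¹c≡1))
  ... | yes refl | yes refl | yes refl = contradiction refl v≢𝟎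

  line-avoiding : (X : Point F) → ∃ λ (e : Line F) → ¬ Incident F X e
  line-avoiding ((_ , y , z) , inj₁ refl) =
    ((1# , 0# , 0#) , inj₁ refl) ,
    1≢0 ∘ trans (sym (solve 2 (λ y z → con 1 :* con 1 :+ con 0 :* y :+ con 0 :* z := con 1) refl y z))
  line-avoiding ((_ , _ , z) , inj₂ (inj₁ (refl , refl))) =
    ((0# , 1# , 0#) , inj₂ (inj₁ (refl , refl))) ,
    1≢0 ∘ trans (sym (solve 1 (λ z → con 0 :* con 0 :+ con 1 :* con 1 :+ con 0 :* z := con 1) refl z))
  line-avoiding (_ , inj₂ (inj₂ (refl , refl , refl))) =
    ((0# , 0# , 1#) , inj₂ (inj₂ (refl , refl , refl))) ,
    1≢0 ∘ trans (sym (solve 0 (con 0 :* con 0 :+ con 0 :* con 0 :+ con 1 :* con 1 := con 1) refl))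

  record LinesThrough (o : Vector) : Set where
    field
      u w : Vector
      u∙o≡0 : u ∙ o ≡ 0#
      w∙o≡0 : w ∙ o ≡ 0#
      independent : ∀ s t → s ⊛ u ⊕ t ⊛ w ≡ 𝟎 → s ≡ 0# × t ≡ 0#

  s*1+t*0≡s : ∀ s t → s * 1# + t * 0# ≡ s
  s*1+t*0≡s = solve 2 (λ s t → s :* con 1 :+ t :* con 0 := s) refl

  s*0+t*1≡t : ∀ s t → s * 0# + t * 1# ≡ t
  s*0+t*1≡t = solve 2 (λ s t → s :* con 0 :+ t :* con 1 := t) refl

  linesThrough : ∀ {o} → Normalized F o → LinesThrough o
  linesThrough {_ , y , z} (inj₁ refl) = record
    { u = - y , 1# , 0#
    ; w = - z , 0# , 1#
    ; u∙o≡0 = trans (solve 3 (λ -y y z → -y :* con 1 :+ con 1 :* y :+ con 0 :* z := -y :+ y) refl (- y) y z)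
                    (-‿inverseˡ y)
    ; w∙o≡0 = trans (solve 3 (λ -z y z → -z :* con 1 :+ con 0 :* y :+ con 1 :* z := -z :+ z) refl (- z) y z)
                    (-‿inverseˡ z)
    ; independent = λ s t eq → trans (sym (s*1+t*0≡s s t)) (cong (proj₁ ∘ proj₂) eq)
                             , trans (sym (s*0+t*1≡t s t)) (cong (proj₂ ∘ proj₂) eq)
    }
  linesThrough {_ , _ , z} (inj₂ (inj₁ (refl , refl))) = record
    { u = 1# , 0# , 0#
    ; w = 0# , - z , 1#
    ; u∙o≡0 = solve 1 (λ z → con 1 :* con 0 :+ con 0 :* con 1 :+ con 0 :* z := con 0) refl z
    ; w∙o≡0 = trans (solve 2 (λ -z z → con 0 :* con 0 :+ -z :* con 1 :+ con 1 :* z := -z :+ z) refl (- z) z)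
                    (-‿inverseˡ z)
    ; independent = λ s t eq → trans (sym (s*1+t*0≡s s t)) (cong proj₁ eq)
                             , trans (sym (s*0+t*1≡t s t)) (cong (proj₂ ∘ proj₂) eq)
    }
  linesThrough (inj₂ (inj₂ (refl , refl , refl))) = record
    { u = 1# , 0# , 0#
    ; w = 0# , 1# , 0#
    ; u∙o≡0 = solve 0 (con 1 :* con 0 :+ con 0 :* con 0 :+ con 0 :* con 1 := con 0) refl
    ; w∙o≡0 = solve 0 (con 0 :* con 0 :+ con 1 :* con 0 :+ con 0 :* con 1 := con 0) refl
    ; independent = λ s t eq → trans (sym (s*1+t*0≡s s t)) (cong proj₁ eq)
                             , trans (sym (s*0+t*1≡t s t)) (cong (proj₁ ∘ proj₂) eq)
    }

module RInfinity (F : FiniteField) (B : List (Point F)) (B-blocking : IsBlockingSet F B)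
                 (P : Point F) (P∈B : _∈ₚ_ F P B)
                 (ℓ : Line F) (P∈ℓ : Incident F P ℓ) (ℓ-tangent : Tangent F B ℓ)
                 (secant : ∀ m → Incident F P m → coords F m ≢ coords F ℓ → Secant F B m) where

  open Field F
  open Bivariate F
  open Plane F
  open Without _≟ᵥ_
  open ≡-Reasoning

  points : List Vector
  points = map (coords F) B

  p L : Vector
  p = coords F P
  L = coords F ℓ

  on? : (n : Vector) → Decidable (λ x → n ∙ x ≡ 0#)
  on? n x = (n ∙ x) ≟ 0#

  meet≡ : ∀ n → meet F B n ≡ length (filter (on? (coords F n)) points)
  meet≡ n = sym (length-filter-map (on? (coords F n)) (coords F) B)

  normalized : ∀ {x} → x ∈ points → Normalized F x
  normalized x∈B with X , _ , refl ← ∈-map⁻ (coords F) x∈B = proj₂ X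

  on-ℓ⇒≡p : ∀ {x} → x ∈ points → L ∙ x ≡ 0# → x ≡ p
  on-ℓ⇒≡p x∈B x∈ℓ =
    length≡1⇒∈-unique (trans (sym (meet≡ ℓ)) ℓ-tangent)
                      (∈-filter⁺ (on? L) x∈B x∈ℓ) (∈-filter⁺ (on? L) P∈B P∈ℓ)

  other-point-on : ∀ (n : Line F) → coords F n ≢ L → ∃ λ x → x ∈ points × x ≢ p × coords F n ∙ x ≡ 0#
  other-point-on n n≢ℓ with on? (coords F n) p
  ... | yes P∈n =
    let x , x∈n∩B , x≢p = Unique∧length≥2⇒∃≢ _≟ᵥ_ p (filter⁺ (on? (coords F n)) (proj₁ B-blocking))
                                              (subst (2 ≤_) (meet≡ n) (secant n P∈n n≢ℓ))
        x∈B , x∈n = ∈-filter⁻ (on? (coords F n)) x∈n∩B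
    in x , x∈B , x≢p , x∈n
  ... | no P∉n =
    let X , X∈n , X∈B = proj₁ (proj₂ B-blocking) n
    in coords F X , X∈B , (λ X≡P → P∉n (subst (λ x → coords F n ∙ x ≡ 0#) X≡P X∈n)) , X∈n

  second-point : ∃ λ o → o ∈ points × o ≢ p
  second-point =
    let e , P∉e = line-avoiding P
        o , o∈B , o≢p , _ = other-point-on e (λ e≡ℓ → P∉e (subst (λ n → n ∙ p ≡ 0#) (sym e≡ℓ) P∈ℓ))
    in o , o∈B , o≢p

  o : Vector
  o = proj₁ second-point

  o∈B : o ∈ points
  o∈B = proj₁ (proj₂ second-point)

  o≢p : o ≢ p
  o≢p = proj₂ (proj₂ second-point)

  L∙o≢0 : L ∙ o ≢ 0#
  L∙o≢0 = o≢p ∘ on-ℓ⇒≡p o∈B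

  open LinesThrough (linesThrough (normalized o∈B))

  pencil : Carrier → Carrier → Vector
  pencil s t = L ⊕ (s ⊛ u ⊕ t ⊛ w)

  form : Vector → Affine
  form x = L ∙ x , u ∙ x , w ∙ x

  pencil∙ : ∀ s t x → pencil s t ∙ x ≡ ⟦ form x ⟧ₐ s t
  pencil∙ s t x = begin
    (L ⊕ (s ⊛ u ⊕ t ⊛ w)) ∙ x              ≡⟨ ∙-distribʳ-⊕ L (s ⊛ u ⊕ t ⊛ w) x ⟩
    L ∙ x + (s ⊛ u ⊕ t ⊛ w) ∙ x            ≡⟨ cong (L ∙ x +_) (∙-distribʳ-⊕ (s ⊛ u) (t ⊛ w) x) ⟩
    L ∙ x + ((s ⊛ u) ∙ x + (t ⊛ w) ∙ x)    ≡⟨ cong (L ∙ x +_) (cong₂ _+_ (∙-⊛ s u x) (∙-⊛ t w x)) ⟩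
    L ∙ x + (s * (u ∙ x) + t * (w ∙ x))    ≡⟨ +-assoc (L ∙ x) _ _ ⟨
    L ∙ x + s * (u ∙ x) + t * (w ∙ x)      ∎

  pencil∙o : ∀ s t → pencil s t ∙ o ≡ L ∙ o
  pencil∙o s t = begin
    pencil s t ∙ o                       ≡⟨ pencil∙ s t o ⟩
    L ∙ o + s * (u ∙ o) + t * (w ∙ o)    ≡⟨ cong₂ (λ y z → L ∙ o + s * y + t * z) u∙o≡0 w∙o≡0 ⟩
    L ∙ o + s * 0# + t * 0#              ≡⟨ solve 3 (λ a s t → a :+ s :* con 0 :+ t :* con 0 := a) refl (L ∙ o) s t ⟩
    L ∙ o                                ∎

  pencil-line : ∀ s t → s ≢ 0# ⊎ t ≢ 0# →
                ∃ λ (n : Line F) → coords F n ≢ L × (∀ x → coords F n ∙ x ≡ 0# → pencil s t ∙ x ≡ 0#)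
  pencil-line s t st≢0 =
    let n , k , k≢0 , n≡k⊛m = normalize m m≢𝟎
    in n , n≢ℓ n≡k⊛m , on-n⇒on-m k≢0 n≡k⊛m
    where
    m = pencil s t
    m≢𝟎 : m ≢ 𝟎
    m≢𝟎 m≡𝟎 = L∙o≢0 (trans (sym (pencil∙o s t)) (trans (cong (_∙ o) m≡𝟎) (∙-zeroˡ o)))
    on-n⇒on-m : ∀ {n k} → k ≢ 0# → n ≡ k ⊛ m → ∀ x → n ∙ x ≡ 0# → m ∙ x ≡ 0#
    on-n⇒on-m {k = k} k≢0 n≡k⊛m x n∙x≡0 =
      x*y≡0⇒y≡0 k≢0 (trans (sym (∙-⊛ k m x)) (trans (cong (_∙ x) (sym n≡k⊛m)) n∙x≡0))
    n≢ℓ : ∀ {n k} → n ≡ k ⊛ m → n ≢ L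
    n≢ℓ n≡k⊛m n≡L =
      let m≡L = proportional⇒≡ (trans (sym n≡k⊛m) n≡L) (pencil∙o s t) L∙o≢0
          s≡0 , t≡0 = independent s t (⊕-identityʳ-unique L _ m≡L)
      in [ (λ s≢0 → s≢0 s≡0) , (λ t≢0 → t≢0 t≡0) ]′ st≢0

  pencil-meets : ∀ s t → s ≢ 0# ⊎ t ≢ 0# → ∃ λ x → x ∈ points × x ≢ p × x ≢ o × pencil s t ∙ x ≡ 0#
  pencil-meets s t st≢0 =
    let n , n≢ℓ , on-n⇒on-m = pencil-line s t st≢0
        x , x∈B , x≢p , x∈n = other-point-on n n≢ℓ
        m∙x≡0 = on-n⇒on-m x x∈n
        x≢o = λ x≡o → L∙o≢0 (trans (sym (pencil∙o s t)) (subst (λ y → pencil s t ∙ y ≡ 0#) x≡o m∙x≡0))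
    in x , x∈B , x≢p , x≢o , m∙x≡0

  rest : List Vector
  rest = (points without p) without o

  forms : List Affine
  forms = map form rest

  2+|forms|≤|B| : 2 ℕ.+ length forms ≤ length B
  2+|forms|≤|B| = subst₂ (λ m n → 2 ℕ.+ m ≤ n) (sym (length-map form rest)) (length-map (coords F) B)
    (ℕₚ.≤-trans (s≤s (length-without (∈-without⁺ o∈B o≢p))) (length-without P∈B))

  ∏forms-vanishes : ∀ s t → s ≢ 0# ⊎ t ≢ 0# → ∏ₐ forms s t ≡ 0#
  ∏forms-vanishes s t st≢0 =
    let x , x∈B , x≢p , x≢o , m∙x≡0 = pencil-meets s t st≢0
    in ∏ₐ-∈ s t (∈-map⁺ form (∈-without⁺ (∈-without⁺ x∈B x≢p) x≢o))
                (trans (sym (pencil∙ s t x)) m∙x≡0)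

  ∏forms-origin≢0 : ∏ₐ forms 0# 0# ≢ 0#
  ∏forms-origin≢0 = ∏ₐ-≢0 0# 0# (Allₚ.map⁺ (All.tabulate form[0]≢0))
    where
    form[0]≢0 : ∀ {x} → x ∈ rest → ⟦ form x ⟧ₐ 0# 0# ≢ 0#
    form[0]≢0 {x} x∈rest =
      let x∈B∖p , _ = ∈-without⁻ x∈rest
          x∈B , x≢p = ∈-without⁻ x∈B∖p
          form[0]≡L∙x = solve 3 (λ a b c → a :+ con 0 :* b :+ con 0 :* c := a) refl (L ∙ x) (u ∙ x) (w ∙ x)
      in x≢p ∘ on-ℓ⇒≡p x∈B ∘ trans (sym form[0]≡L∙x)

open import Data.Nat using (_*_)

theorem4p1 : (F : FiniteField) → (B : List (Point F)) → IsBlockingSet F B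
    → length B ≤ 2 * FiniteField.order F ∸ 1
    → ∀ (P : Point F) → _∈ₚ_ F P B → ¬ HasRInfProperty F B P
theorem4p1 F B B-blocking |B|≤2q-1 P P∈B (ℓ , P∈ℓ , ℓ-tangent , secant) =
  ∏forms-origin≢0 (∏ₐ-vanishes-at-origin forms (ℕₚ.≤-trans 2+|forms|≤|B| |B|≤2q-1) ∏forms-vanishes)
  where
  open Bivariate F using (∏ₐ-vanishes-at-origin)
  open RInfinity F B B-blocking P P∈B ℓ P∈ℓ ℓ-tangent secant
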